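{- Let $\overrightarrow{C}$ be an oriented $2$-regular graph with at least two cycle components. Then $\overrightarrow{C}$ is $\{1\}$-antimagic if and only if at most one of its cycle components is $\Theta$-oriented and all the other cycle components are unidirectional.
   Context: An oriented $2$-regular graph is an orientation of a finite disjoint union of cycles, each of length at least $3$. A cycle component on vertices $v_1,\dots,v_n$ is unidirectional if (for a suitable labeling) its arcs are $(v_i,v_{i+1})$, $1\le i\le n-1$, and $(v_n,v_1)$; it is $\Theta$-oriented if (for a suitable labeling) its arcs are $(v_i,v_{i+1})$, $1\le i\le n-1$, and $(v_1,v_n)$ (exactly one source and one sink, adjacent). $d(u,y)$ is the length of a shortest directed path from $u$ to $y$ ($d(u,u)=0$, $\infty$ if none). For a set $D$ of distances, $N_D(v)=\{y:d(v,y)\in D\}$; a bijection $f:V\to\{1,\dots,|V|\}$ is $D$-antimagic if the $D$-weights $\omega_D(v)=\sum_{y\in N_D(v)}f(y)$ are pairwise distinct; the graph is $D$-antimagic if such a bijection exists. -}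

module Defs where

open import Data.Nat using (ℕ; zero; suc; _+_; _<_; _≤_)
open import Data.Nat.Properties using (_<?_)
open import Data.Bool using (Bool; true; false; _∧_; _∨_; not; if_then_else_; T)
open import Data.Fin using (Fin; toℕ; fromℕ; fromℕ<)
open import Data.Fin.Properties using (_≟_)
open import Data.List using (List; map; concatMap)
open import Data.Nat.ListAction using (sum)
open import Data.List.Base using (allFin)
open import Data.Product using (Σ; ∃; _×_; _,_)
open import Data.Sum using (_⊎_)
open import Relation.Nullary using (yes; no)
open import Relation.Nullary.Decidable using (⌊_⌋)
open import Relation.Binary.PropositionalEquality using (_≡_; refl)
open import Function.Bundles using (_⤖_; _⇔_; Bijection)

next : {m : ℕ} → Fin (suc m) → Fin (suc m)
next {m} i with suc (toℕ i) <? suc m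
... | yes p = fromℕ< p
... | no _  = Fin.zero

-- The underlying cycle has the edges {i , next i}; orient i = true means
-- the edge {i , next i} is oriented as the arc (i , next i), false means
-- it is oriented as the arc (next i , i).  Every orientation of C_n
-- (n ≥ 3) arises this way (up to relabelling vertices).

record OCycle : Set where
  field
    len    : ℕ
    orient : Fin (3 + len) → Bool

size : OCycle → ℕ
size C = 3 + OCycle.len C

carc : (C : OCycle) → Fin (size C) → Fin (size C) → Bool
carc C i j =
  (OCycle.orient C i ∧ ⌊ j ≟ next i ⌋) ∨ (not (OCycle.orient C j) ∧ ⌊ i ≟ next j ⌋)

CArc : (C : OCycle) → Fin (size C) → Fin (size C) → Set
CArc C i j = T (carc C i j)

Unidirectional : OCycle → Set
Unidirectional C =
  Σ (Fin (size C) ⤖ Fin (size C)) λ σ → let v = Bijection.to σ in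
    ∀ x y → CArc C x y ⇔
      ((Σ (Fin (size C)) λ i → suc (toℕ i) < size C × x ≡ v i × y ≡ v (next i))
       ⊎ (x ≡ v (fromℕ (2 + OCycle.len C)) × y ≡ v Fin.zero))

ThetaOriented : OCycle → Set
ThetaOriented C =
  Σ (Fin (size C) ⤖ Fin (size C)) λ σ → let v = Bijection.to σ in
    ∀ x y → CArc C x y ⇔
      ((Σ (Fin (size C)) λ i → suc (toℕ i) < size C × x ≡ v i × y ≡ v (next i))
       ⊎ (x ≡ v Fin.zero × y ≡ v (fromℕ (2 + OCycle.len C))))

record O2RGraph : Set where
  field
    m    : ℕ
    comp : Fin m → OCycle

module _ (G : O2RGraph) where
  open O2RGraph G

  Vertex : Set
  Vertex = Σ (Fin m) λ c → Fin (size (comp c))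

  allVertices : List Vertex
  allVertices = concatMap (λ c → map (λ i → (c , i)) (allFin (size (comp c)))) (allFin m)

  order : ℕ
  order = sum (map (λ c → size (comp c)) (allFin m))

  arc : Vertex → Vertex → Bool
  arc (c , i) (c' , j) with c ≟ c'
  ... | yes refl = carc (comp c) i j
  ... | no _     = false

  -- N_{1}(v) = {y : d(v,y) = 1}; d(v,y) = 1 holds iff (v , y) is an arc.
  -- ω_{1}(v) = Σ_{y ∈ N_{1}(v)} f(y), with labels f(y) = 1 + toℕ (F y) ∈ {1,…,|V|}
  weight1 : (Vertex ⤖ Fin order) → Vertex → ℕ
  weight1 F v =
    sum (map (λ y → if arc v y then suc (toℕ (Bijection.to F y)) else 0) allVertices)

  Antimagic1 : Set
  Antimagic1 = Σ (Vertex ⤖ Fin order) λ F →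
    ∀ u v → weight1 F u ≡ weight1 F v → u ≡ v

-- The {1}-weight of a vertex is the sum of the labels of its out-neighbours, so it depends only on its
-- out-neighbourhood.  If a labelling is antimagic, distinct vertices of a cycle have distinct
-- out-neighbourhoods.  Then a cycle has at most one sink, and a sink is adjacent to a source: otherwise
-- both neighbours of the sink have the sink as their only out-neighbour.  Up to rotation and reflection,
-- such a cycle is oriented forward everywhere (unidirectional) or everywhere but on the edge from the
-- last vertex back to 0 (Θ-oriented).  Sinks have weight 0, so at most one component is Θ-oriented.
-- Conversely, in such a graph every vertex has exactly one out-neighbour, except the sink and the source
-- of the Θ-oriented component; the source points to the sink and to one other vertex.  Give the sink the
-- largest label.  Then the sink has weight 0, the vertices with one out-neighbour have distinct labels as
-- weights (no vertex is the only out-neighbour of two vertices), and the weight of the source exceeds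
-- every label.

module Submission where

open import Defs
open import Data.Bool using (Bool; true; false; not; T; if_then_else_)
import Data.Bool.Properties as Bool
open import Data.Bool.Properties using (T-≡; T-not-≡; T-∧; T-∨; not-injective)
open import Data.Empty using (⊥-elim)
open import Data.Fin using (Fin; toℕ; fromℕ; inject₁; opposite) renaming (zero to 0F; suc to sucF)
open import Data.Fin.Induction using (<-weakInduction)
import Data.Fin.Permutation as Perm
import Data.Fin.Permutation.Components as PC
open import Data.Fin.Properties
  using (_≟_; any?; all?; +↔⊎; ≤fromℕ; toℕ-injective; toℕ-fromℕ; toℕ-fromℕ<; toℕ-inject₁; inject₁ℕ<;
         fromℕ≢inject₁; opposite-involutive)
  renaming (suc-injective to sucF-injective)
open import Data.List using (List; []; _∷_; _++_; map; concatMap; allFin)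
open import Data.List.Properties using (map-tabulate; map-cong; map-++; map-∘)
open import Data.Nat using (ℕ; zero; suc; _+_; _<_; _≤_; s≤s; z≤n; s≤s⁻¹)
open import Data.Nat.ListAction using (sum)
open import Data.Nat.ListAction.Properties using (sum-++)
open import Data.Nat.Properties
  using (_<?_; <-irrefl; suc-injective; +-identityʳ; +-comm; <⇒≢; m<n+m; module ≤-Reasoning)
open import Data.Product using (Σ; ∃; ∃₂; _×_; _,_; proj₁; proj₂)
open import Data.Product.Function.NonDependent.Propositional using (_×-⇔_)
import Data.Sum as Sum
open import Data.Sum using (_⊎_; inj₁; inj₂)
open import Data.Sum.Function.Propositional using (_⊎-⇔_; _⊎-↔_)
open import Function.Base using (_$_; _∘_)
open import Function.Bundles using (_⤖_; _↔_; _⇔_; Bijection; Inverse; Equivalence; mk↔ₛ′; mk⇔)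
open import Function.Construct.Composition using (_↔-∘_; _⇔-∘_)
open import Function.Construct.Identity using (⇔-id; ↔-id)
open import Function.Construct.Symmetry using (↔-sym; ⇔-sym)
open import Function.Properties.Bijection using (⤖⇒↔)
open import Function.Properties.Inverse using (↔⇒⤖)
open import Relation.Binary.PropositionalEquality
open import Relation.Nullary using (¬_; Dec; yes; no; contradiction)
open import Relation.Nullary.Decidable using (⌊_⌋; toWitness; fromWitness; _×-dec_; ¬?; T?)

module _ {A B : Set} (σ : A ↔ B) where
  open Inverse σ

  to-injective : ∀ {a a′} → to a ≡ to a′ → a ≡ a′
  to-injective {a} {a′} e = trans (sym (strictlyInverseʳ a)) (trans (cong from e) (strictlyInverseʳ a′))

  from≡⇔ : ∀ {b a} → from b ≡ a ⇔ b ≡ to a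
  from≡⇔ = mk⇔ (λ e → trans (sym (strictlyInverseˡ _)) (cong to e)) (λ e → trans (cong from e) (strictlyInverseʳ _))

  ∀-via-to : {P : B → Set} → (∀ a → P (to a)) → ∀ b → P b
  ∀-via-to {P} p b = subst P (strictlyInverseˡ b) (p (from b))

  ∀₂-via-to : {P : B → B → Set} → (∀ a a′ → P (to a) (to a′)) → ∀ b b′ → P b b′
  ∀₂-via-to {P} p b b′ = subst₂ P (strictlyInverseˡ b) (strictlyInverseˡ b′) (p (from b) (from b′))

-- Cyclic order on Fin (suc m)

fromℕ-or-inject₁ : ∀ {m} (i : Fin (suc m)) → i ≡ fromℕ m ⊎ ∃ λ k → i ≡ inject₁ k
fromℕ-or-inject₁ {zero}  0F       = inj₁ refl
fromℕ-or-inject₁ {suc m} 0F       = inj₂ (0F , refl)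
fromℕ-or-inject₁ {suc m} (sucF i) with fromℕ-or-inject₁ i
... | inj₁ refl      = inj₁ refl
... | inj₂ (k , refl) = inj₂ (sucF k , refl)

opposite-fromℕ : ∀ m → opposite (fromℕ m) ≡ 0F
opposite-fromℕ zero    = refl
opposite-fromℕ (suc m) = cong inject₁ (opposite-fromℕ m)

opposite-inject₁ : ∀ {m} (k : Fin m) → opposite (inject₁ k) ≡ sucF (opposite k)
opposite-inject₁ {suc m} 0F       = refl
opposite-inject₁ {suc m} (sucF k) = cong inject₁ (opposite-inject₁ k)

module _ {m : ℕ} where

  prev : Fin (suc m) → Fin (suc m)
  prev 0F       = fromℕ m
  prev (sucF i) = inject₁ i

  next-fromℕ : next (fromℕ m) ≡ 0F
  next-fromℕ with suc (toℕ (fromℕ m)) <? suc m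
  ... | yes p = contradiction (subst (λ k → suc k < suc m) (toℕ-fromℕ m) p) (<-irrefl refl)
  ... | no _  = refl

  next-inject₁ : (i : Fin m) → next (inject₁ i) ≡ sucF i
  next-inject₁ i with suc (toℕ (inject₁ i)) <? suc m
  ... | yes p = toℕ-injective (trans (toℕ-fromℕ< p) (cong suc (toℕ-inject₁ i)))
  ... | no ¬p = contradiction (s≤s (inject₁ℕ< i)) ¬p

  next-prev : (i : Fin (suc m)) → next (prev i) ≡ i
  next-prev 0F       = next-fromℕ
  next-prev (sucF i) = next-inject₁ i

  prev-next : (i : Fin (suc m)) → prev (next i) ≡ i
  prev-next i with fromℕ-or-inject₁ i
  ... | inj₁ refl       = cong prev next-fromℕ
  ... | inj₂ (k , refl) = cong prev (next-inject₁ k)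

  next-injective : {i j : Fin (suc m)} → next i ≡ next j → i ≡ j
  next-injective {i} {j} eq = trans (sym (prev-next i)) (trans (cong prev eq) (prev-next j))

  opposite-next : (i : Fin (suc m)) → opposite (next i) ≡ prev (opposite i)
  opposite-next i with fromℕ-or-inject₁ i
  ... | inj₁ refl       = trans (cong opposite next-fromℕ) (cong prev (sym (opposite-fromℕ m)))
  ... | inj₂ (k , refl) = trans (cong opposite (next-inject₁ k)) (cong prev (sym (opposite-inject₁ k)))

  rotate : ℕ → Fin (suc m) → Fin (suc m)
  rotate zero    i = i
  rotate (suc r) i = next (rotate r i)

  unrotate : ℕ → Fin (suc m) → Fin (suc m)
  unrotate zero    i = i
  unrotate (suc r) i = unrotate r (prev i)

  rotate-unrotate : ∀ r i → rotate r (unrotate r i) ≡ i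
  rotate-unrotate zero    i = refl
  rotate-unrotate (suc r) i = trans (cong next (rotate-unrotate r (prev i))) (next-prev i)

  unrotate-rotate : ∀ r i → unrotate r (rotate r i) ≡ i
  unrotate-rotate zero    i = refl
  unrotate-rotate (suc r) i = trans (cong (unrotate r) (prev-next (rotate r i))) (unrotate-rotate r i)

  rotation : ℕ → Fin (suc m) ↔ Fin (suc m)
  rotation r = mk↔ₛ′ (rotate r) (unrotate r) (rotate-unrotate r) (unrotate-rotate r)

  rotate-next : ∀ r i → rotate r (next i) ≡ next (rotate r i)
  rotate-next zero    i = refl
  rotate-next (suc r) i = cong next (rotate-next r i)

  rotate-prev : ∀ r i → rotate r (prev i) ≡ prev (rotate r i)
  rotate-prev r i = next-injective (begin
    next (rotate r (prev i)) ≡⟨ rotate-next r (prev i) ⟨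
    rotate r (next (prev i)) ≡⟨ cong (rotate r) (next-prev i) ⟩
    rotate r i               ≡⟨ next-prev (rotate r i) ⟨
    next (prev (rotate r i)) ∎)
    where open ≡-Reasoning

  rotate-toℕ : (i : Fin (suc m)) → rotate (toℕ i) 0F ≡ i
  rotate-toℕ = <-weakInduction (λ i → rotate (toℕ i) 0F ≡ i) refl step
    where
    step : ∀ k → rotate (toℕ (inject₁ k)) 0F ≡ inject₁ k → rotate (toℕ (sucF k)) 0F ≡ sucF k
    step k ih = trans (cong next (trans (cong (λ t → rotate t 0F) (sym (toℕ-inject₁ k))) ih)) (next-inject₁ k)

  rotate-fromℕ : (i : Fin (suc m)) → rotate (suc (toℕ i)) (fromℕ m) ≡ i
  rotate-fromℕ i =
    trans (sym (rotate-next (toℕ i) (fromℕ m))) (trans (cong (rotate (toℕ i)) next-fromℕ) (rotate-toℕ i))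

  <⇒≢fromℕ : {i : Fin (suc m)} → suc (toℕ i) < suc m → i ≢ fromℕ m
  <⇒≢fromℕ {i} p refl = <-irrefl (toℕ-fromℕ m) (s≤s⁻¹ p)

  ≢fromℕ⇒< : {i : Fin (suc m)} → i ≢ fromℕ m → suc (toℕ i) < suc m
  ≢fromℕ⇒< {i} i≢ with fromℕ-or-inject₁ i
  ... | inj₁ i≡      = contradiction i≡ i≢
  ... | inj₂ (k , refl) = s≤s (inject₁ℕ< k)

next²≢id : ∀ {k} (i : Fin (3 + k)) → next (next i) ≢ i
next²≢id i e = contradiction (to-injective (rotation r) rotated-equal) λ ()
  where
  r = toℕ i
  rotated-equal : rotate r (next (next 0F)) ≡ rotate r 0F
  rotated-equal = begin
    rotate r (next (next 0F))  ≡⟨ rotate-next r (next 0F) ⟩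
    next (rotate r (next 0F))  ≡⟨ cong next (rotate-next r 0F) ⟩
    next (next (rotate r 0F))  ≡⟨ cong (next ∘ next) (rotate-toℕ i) ⟩
    next (next i)              ≡⟨ e ⟩
    i                          ≡⟨ rotate-toℕ i ⟨
    rotate r 0F                ∎
    where open ≡-Reasoning

-- Digraphs are represented by their arc relations; R ≅ E says that (B , E) is isomorphic to (A , R).
record _≅_ {A B : Set} (R : A → A → Set) (E : B → B → Set) : Set where
  constructor mk≅
  field
    relabelling : B ↔ A
    arcs        : ∀ i j → R (Inverse.to relabelling i) (Inverse.to relabelling j) ⇔ E i j

open _≅_ using (relabelling)

module _ {A B : Set} {R : A → A → Set} {E : B → B → Set} where

  ≅-sym : R ≅ E → E ≅ R
  ≅-sym (mk≅ σ hom) = mk≅ (↔-sym σ) $ ∀₂-via-to σ (λ i j → subst₂ (λ x y → E x y ⇔ R (to i) (to j))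
    (sym (strictlyInverseʳ i)) (sym (strictlyInverseʳ j)) (⇔-sym (hom i j)))
    where open Inverse σ

  ≅-trans : {D : Set} {S : D → D → Set} → R ≅ S → S ≅ E → R ≅ E
  ≅-trans (mk≅ σ hom) (mk≅ τ hom′) =
    mk≅ (σ ↔-∘ τ) λ i j → hom′ i j ⇔-∘ hom (Inverse.to τ i) (Inverse.to τ j)

module _ {A : Set} (R : A → A → Set) where

  Sink : A → Set
  Sink x = ∀ z → ¬ R x z

  OutOnly : A → A → Set
  OutOnly x y = ∀ z → R x z ⇔ z ≡ y

  OutPair : A → A → A → Set
  OutPair x a b = a ≢ b × (∀ z → R x z ⇔ (z ≡ a ⊎ z ≡ b))

  Kind : A → Set
  Kind x = Sink x ⊎ (∃ λ y → OutOnly x y) ⊎ (∃₂ λ a b → OutPair x a b × Sink b)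

  DistinctRows : Set
  DistinctRows = ∀ x x′ → (∀ z → R x z ⇔ R x′ z) → x ≡ x′

  sinks-equal : DistinctRows → ∀ {x x′} → Sink x → Sink x′ → x ≡ x′
  sinks-equal distinct s s′ = distinct _ _ λ z → mk⇔ (⊥-elim ∘ s z) (⊥-elim ∘ s′ z)

  outOnly-equal : DistinctRows → ∀ {x x′ y} → OutOnly x y → OutOnly x′ y → x ≡ x′
  outOnly-equal distinct o o′ = distinct _ _ λ z → ⇔-sym (o′ z) ⇔-∘ o z

module _ {A B : Set} {R : A → A → Set} {E : B → B → Set} (iso : R ≅ E) where
  open Inverse (relabelling iso)

  private
    arc-from : ∀ i z → R (to i) z ⇔ E i (from z)
    arc-from i z = subst (λ z′ → R (to i) z′ ⇔ E i (from z)) (strictlyInverseˡ z) (_≅_.arcs iso i (from z))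

  sink-transport : ∀ {i} → Sink E i → Sink R (to i)
  sink-transport {i} s z r = s (from z) (Equivalence.to (arc-from i z) r)

  outOnly-transport : ∀ {i j} → OutOnly E i j → OutOnly R (to i) (to j)
  outOnly-transport {i} o z = from≡⇔ (relabelling iso) ⇔-∘ (o (from z) ⇔-∘ arc-from i z)

  outPair-transport : ∀ {i a b} → OutPair E i a b → OutPair R (to i) (to a) (to b)
  outPair-transport {i} (a≢b , o) =
    (λ e → a≢b (to-injective (relabelling iso) e)) ,
    λ z → (from≡⇔ (relabelling iso) ⊎-⇔ from≡⇔ (relabelling iso)) ⇔-∘ (o (from z) ⇔-∘ arc-from i z)

  kind-transport : ∀ {i} → Kind E i → Kind R (to i)
  kind-transport (inj₁ s)                      = inj₁ (sink-transport s)
  kind-transport (inj₂ (inj₁ (y , o)))         = inj₂ (inj₁ (to y , outOnly-transport o))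
  kind-transport (inj₂ (inj₂ (a , b , p , s))) = inj₂ (inj₂ (to a , to b , outPair-transport p , sink-transport s))

module _ {A B : Set} {R : A → A → Set} {E : B → B → Set} (iso : R ≅ E) where
  private
    pull : E ≅ R
    pull = ≅-sym iso

    from-injective : ∀ {x x′} → Inverse.from (relabelling iso) x ≡ Inverse.from (relabelling iso) x′ → x ≡ x′
    from-injective = to-injective (relabelling pull)

  sink-unique-transport : (∀ {i i′} → Sink E i → Sink E i′ → i ≡ i′) →
    ∀ {x x′} → Sink R x → Sink R x′ → x ≡ x′
  sink-unique-transport u {x} {x′} s s′ = from-injective (u (sink-transport pull {x} s) (sink-transport pull {x′} s′))

  outOnly-injective-transport : (∀ {i i′ j} → OutOnly E i j → OutOnly E i′ j → i ≡ i′) →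
    ∀ {x x′ y} → OutOnly R x y → OutOnly R x′ y → x ≡ x′
  outOnly-injective-transport u {x} {x′} {y} o o′ =
    from-injective (u (outOnly-transport pull {x} {y} o) (outOnly-transport pull {x′} {y} o′))

  outPair-unique-transport : (∀ {i i′ a b a′ b′} → OutPair E i a b → OutPair E i′ a′ b′ → i ≡ i′) →
    ∀ {x x′ a b a′ b′} → OutPair R x a b → OutPair R x′ a′ b′ → x ≡ x′
  outPair-unique-transport u {x} {x′} {a} {b} {a′} {b′} p p′ =
    from-injective (u (outPair-transport pull {x} {a} {b} p) (outPair-transport pull {x′} {a′} {b′} p′))

-- The two standard orientations

module _ {m : ℕ} where

  PathArc : Fin (suc m) → Fin (suc m) → Set
  PathArc i j = suc (toℕ i) < suc m × j ≡ next i

  PathWith : Fin (suc m) → Fin (suc m) → Fin (suc m) → Fin (suc m) → Set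
  PathWith a b i j = PathArc i j ⊎ (i ≡ a × j ≡ b)

  CycleArc : Fin (suc m) → Fin (suc m) → Set
  CycleArc i j = j ≡ next i

  ThetaArc : Fin (suc m) → Fin (suc m) → Set
  ThetaArc = PathWith 0F (fromℕ m)

  pathWith-closing-≅ : PathWith (fromℕ m) 0F ≅ CycleArc
  pathWith-closing-≅ = mk≅ (↔-id _) λ i j → mk⇔ to (from i j)
    where
    to : ∀ {i j} → PathWith (fromℕ m) 0F i j → CycleArc i j
    to (inj₁ (_ , e))       = e
    to (inj₂ (refl , refl)) = sym next-fromℕ
    from : ∀ i j → CycleArc i j → PathWith (fromℕ m) 0F i j
    from i j e with i ≟ fromℕ m
    ... | yes refl = inj₂ (refl , trans e next-fromℕ)
    ... | no i≢    = inj₁ (≢fromℕ⇒< i≢ , e)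

module _ {m : ℕ} (σ : Fin (suc m) ↔ Fin (suc m)) (a b : Fin (suc m)) where
  private
    v = Inverse.to σ

  -- the shape of the arc relation in the definitions of Unidirectional and ThetaOriented
  LabelledPathWith : Fin (suc m) → Fin (suc m) → Set
  LabelledPathWith x y =
    (Σ (Fin (suc m)) λ i → suc (toℕ i) < suc m × x ≡ v i × y ≡ v (next i)) ⊎ (x ≡ v a × y ≡ v b)

  labelledPathWith⇔ : ∀ i j → LabelledPathWith (v i) (v j) ⇔ PathWith a b i j
  labelledPathWith⇔ i j = mk⇔ to from
    where
    to : LabelledPathWith (v i) (v j) → PathWith a b i j
    to (inj₁ (k , p , e₁ , e₂)) with to-injective σ e₁
    ... | refl = inj₁ (p , to-injective σ e₂)
    to (inj₂ (e₁ , e₂)) = inj₂ (to-injective σ e₁ , to-injective σ e₂)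
    from : PathWith a b i j → LabelledPathWith (v i) (v j)
    from (inj₁ (p , e))   = inj₁ (i , p , refl , cong v e)
    from (inj₂ (e₁ , e₂)) = inj₂ (cong v e₁ , cong v e₂)

labelling⇔ : ∀ {m} {R : Fin (suc m) → Fin (suc m) → Set} (a b : Fin (suc m)) →
  (Σ (Fin (suc m) ⤖ Fin (suc m)) λ σ → ∀ x y → R x y ⇔ LabelledPathWith (⤖⇒↔ σ) a b x y)
    ⇔ (R ≅ PathWith a b)
labelling⇔ a b = mk⇔
  (λ (σ , h) → mk≅ (⤖⇒↔ σ) λ i j → labelledPathWith⇔ (⤖⇒↔ σ) a b i j ⇔-∘ h _ _)
  (λ (mk≅ σ hom) → ↔⇒⤖ σ , ∀₂-via-to σ λ i j → ⇔-sym (labelledPathWith⇔ σ a b i j) ⇔-∘ hom i j)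

unidirectional⇔ : (C : OCycle) → Unidirectional C ⇔ (CArc C ≅ CycleArc)
unidirectional⇔ C = mk⇔
  (λ u → ≅-trans {R = CArc C} (Equivalence.to closing u) pathWith-closing-≅)
  (λ iso → Equivalence.from closing (≅-trans {R = CArc C} iso (≅-sym pathWith-closing-≅)))
  where closing = labelling⇔ {R = CArc C} (fromℕ _) 0F

thetaOriented⇔ : (C : OCycle) → ThetaOriented C ⇔ (CArc C ≅ ThetaArc)
thetaOriented⇔ C = labelling⇔ {R = CArc C} 0F (fromℕ _)

module _ {m : ℕ} where

  cycleArc-outOnly : (i : Fin (suc m)) → OutOnly CycleArc i (next i)
  cycleArc-outOnly i z = ⇔-id _

  cycleArc-¬sink : {i : Fin (suc m)} → ¬ Sink CycleArc i
  cycleArc-¬sink {i} s = s (next {m} i) refl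

  cycleArc-outOnly-injective : {i i′ j : Fin (suc m)} → OutOnly CycleArc i j → OutOnly CycleArc i′ j → i ≡ i′
  cycleArc-outOnly-injective {i} {i′} o o′ =
    next-injective {m} (trans (sym (Equivalence.from (o _) refl)) (Equivalence.from (o′ _) refl))

module _ {k : ℕ} where
  private
    L : Fin (3 + k)
    L = fromℕ (2 + k)

    Θ : Fin (3 + k) → Fin (3 + k) → Set
    Θ = ThetaArc

  thetaArc-sink : Sink Θ L
  thetaArc-sink z (inj₁ (p , _)) = <⇒≢fromℕ p refl
  thetaArc-sink z (inj₂ (() , _))

  thetaArc-from-inner : ∀ {i z} → i ≢ 0F → Θ i z → z ≡ next i
  thetaArc-from-inner i≢0 (inj₁ (_ , e))  = e
  thetaArc-from-inner i≢0 (inj₂ (i≡0 , _)) = contradiction i≡0 i≢0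

  thetaArc-kind : ∀ i → Kind Θ i
  thetaArc-kind i with i ≟ L | i ≟ 0F
  ... | yes refl | _        = inj₁ thetaArc-sink
  ... | no _     | yes refl = inj₂ (inj₂ (next 0F , L , ((λ ()) , source) , thetaArc-sink))
    where
    source : ∀ z → Θ 0F z ⇔ (z ≡ next 0F ⊎ z ≡ L)
    source z = mk⇔ (λ { (inj₁ (_ , e)) → inj₁ e ; (inj₂ (_ , e)) → inj₂ e })
                   (λ { (inj₁ e) → inj₁ (s≤s (s≤s z≤n) , e) ; (inj₂ e) → inj₂ (refl , e) })
  ... | no i≢L   | no i≢0   =
    inj₂ (inj₁ (next i , λ z → mk⇔ (thetaArc-from-inner i≢0) λ e → inj₁ (≢fromℕ⇒< i≢L , e)))

  thetaArc-sink-unique : ∀ {i i′} → Sink Θ i → Sink Θ i′ → i ≡ i′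
  thetaArc-sink-unique {i} {i′} s s′ = trans (is-last s) (sym (is-last s′))
    where
    is-last : ∀ {j} → Sink Θ j → j ≡ L
    is-last {j} s with j ≟ L
    ... | yes j≡L = j≡L
    ... | no j≢L  = contradiction (inj₁ (≢fromℕ⇒< j≢L , refl)) (s (next j))

  thetaArc-outPair-unique : ∀ {i i′ a b a′ b′} → OutPair Θ i a b → OutPair Θ i′ a′ b′ → i ≡ i′
  thetaArc-outPair-unique p p′ = trans (is-first p) (sym (is-first p′))
    where
    is-first : ∀ {j a b} → OutPair Θ j a b → j ≡ 0F
    is-first {j} {a} {b} (a≢b , o) with j ≟ 0F
    ... | yes j≡0 = j≡0
    ... | no j≢0  = contradiction (trans (to-next (inj₁ refl)) (sym (to-next (inj₂ refl)))) a≢b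
      where
      to-next : ∀ {z} → z ≡ a ⊎ z ≡ b → z ≡ next j
      to-next {z} e = thetaArc-from-inner j≢0 (Equivalence.from (o z) e)

  thetaArc-outOnly-injective : ∀ {i i′ j} → OutOnly Θ i j → OutOnly Θ i′ j → i ≡ i′
  thetaArc-outOnly-injective o o′ = next-injective (trans (sym (to-next o)) (to-next o′))
    where
    to-next : ∀ {i j} → OutOnly Θ i j → j ≡ next i
    to-next {i} o with Equivalence.from (o _) refl
    ... | inj₁ (_ , e)       = e
    ... | inj₂ (refl , refl) = contradiction (Equivalence.to (o (next 0F)) (inj₁ (s≤s (s≤s z≤n) , refl))) λ ()

module _ (C : OCycle) where
  private
    U⇒≅ : Unidirectional C → CArc C ≅ CycleArc
    U⇒≅ = Equivalence.to (unidirectional⇔ C)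

    Θ⇒≅ : ThetaOriented C → CArc C ≅ ThetaArc
    Θ⇒≅ = Equivalence.to (thetaOriented⇔ C)

  kind : Unidirectional C ⊎ ThetaOriented C → ∀ x → Kind (CArc C) x
  kind (inj₁ u) = ∀-via-to (relabelling (U⇒≅ u)) λ i →
    kind-transport (U⇒≅ u) (inj₂ (inj₁ (next i , cycleArc-outOnly i)))
  kind (inj₂ θ) = ∀-via-to (relabelling (Θ⇒≅ θ)) λ i → kind-transport (Θ⇒≅ θ) (thetaArc-kind i)

  outOnly-injective : Unidirectional C ⊎ ThetaOriented C →
    ∀ {x x′ y} → OutOnly (CArc C) x y → OutOnly (CArc C) x′ y → x ≡ x′
  outOnly-injective (inj₁ u) = outOnly-injective-transport (U⇒≅ u) cycleArc-outOnly-injective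
  outOnly-injective (inj₂ θ) = outOnly-injective-transport (Θ⇒≅ θ) thetaArc-outOnly-injective

  thetaOriented-of-sink : Unidirectional C ⊎ ThetaOriented C → ∀ {x} → Sink (CArc C) x → ThetaOriented C
  thetaOriented-of-sink (inj₁ u) {x} s =
    ⊥-elim (cycleArc-¬sink {i = Inverse.from (relabelling (U⇒≅ u)) x} (sink-transport (≅-sym (U⇒≅ u)) {x} s))
  thetaOriented-of-sink (inj₂ θ) s = θ

  sink-unique : ThetaOriented C → ∀ {x x′} → Sink (CArc C) x → Sink (CArc C) x′ → x ≡ x′
  sink-unique θ = sink-unique-transport (Θ⇒≅ θ) thetaArc-sink-unique

  outPair-unique : ThetaOriented C → ∀ {x x′ a b a′ b′} →
    OutPair (CArc C) x a b → OutPair (CArc C) x′ a′ b′ → x ≡ x′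
  outPair-unique θ = outPair-unique-transport (Θ⇒≅ θ) thetaArc-outPair-unique

  thetaOriented-sink : ThetaOriented C → ∃ (Sink (CArc C))
  thetaOriented-sink θ = _ , sink-transport (Θ⇒≅ θ) thetaArc-sink

-- Oriented cycles with distinct out-neighbourhoods

OArc : (C : OCycle) → Fin (size C) → Fin (size C) → Set
OArc C x y = (OCycle.orient C x ≡ true × y ≡ next x) ⊎ (OCycle.orient C y ≡ false × x ≡ next y)

CArc⇔ : (C : OCycle) → ∀ {x y} → CArc C x y ⇔ OArc C x y
CArc⇔ C = ((T-≡ ×-⇔ T-≟) ⊎-⇔ (T-not-≡ ×-⇔ T-≟)) ⇔-∘ ((T-∧ ⊎-⇔ T-∧) ⇔-∘ T-∨)
  where
  T-≟ : ∀ {i j : Fin (size C)} → T ⌊ i ≟ j ⌋ ⇔ i ≡ j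
  T-≟ = mk⇔ toWitness fromWitness

-- both edges at s point into s
Inward : (C : OCycle) → Fin (size C) → Set
Inward C s = OCycle.orient C (prev s) ≡ true × OCycle.orient C s ≡ false

inward? : (C : OCycle) → ∀ s → Dec (Inward C s)
inward? C s = (OCycle.orient C (prev s) Bool.≟ true) ×-dec (OCycle.orient C s Bool.≟ false)

sink? : (C : OCycle) → ∀ x → Dec (Sink (CArc C) x)
sink? C x = all? λ z → ¬? (T? (carc C x z))

reorient : (C : OCycle) → (Fin (size C) → Bool) → OCycle
reorient C o = record { len = OCycle.len C ; orient = o }

rotated : ℕ → OCycle → OCycle
rotated r C = reorient C (OCycle.orient C ∘ rotate r)

-- opposite reverses the cyclic order: the edge {i , next i} is the image of the edge
-- {prev (opposite i) , opposite i} of C, traversed the other way round.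
reflected : OCycle → OCycle
reflected C = reorient C λ i → not (OCycle.orient C (prev (opposite i)))

module _ (C : OCycle) where
  private
    o = OCycle.orient C

    L : Fin (size C)
    L = fromℕ (2 + OCycle.len C)

  orient-prev : ∀ {x z} → x ≡ next z → o (prev x) ≡ o z
  orient-prev {z = z} refl = cong o (prev-next z)

  inward⇒sink : ∀ {s} → Inward C s → Sink (CArc C) s
  inward⇒sink {s} (in-prev , in-s) z a with Equivalence.to (CArc⇔ C) a
  ... | inj₁ (out-s , _)  = contradiction (trans (sym out-s) in-s) λ ()
  ... | inj₂ (in-z , s≡) = contradiction (trans (sym in-prev) (trans (orient-prev s≡) in-z)) λ ()

  after-sink-outOnly : ∀ {s} → o s ≡ false → o (next s) ≡ false → OutOnly (CArc C) (next s) s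
  after-sink-outOnly {s} in-s in-next z = mk⇔ to from ⇔-∘ CArc⇔ C
    where
    to : OArc C (next s) z → z ≡ s
    to (inj₁ (out-next , _)) = contradiction (trans (sym out-next) in-next) λ ()
    to (inj₂ (_ , e))        = sym (next-injective e)
    from : z ≡ s → OArc C (next s) z
    from refl = inj₂ (in-s , refl)

  before-sink-outOnly : ∀ {s} → o (prev s) ≡ true → o (prev (prev s)) ≡ true → OutOnly (CArc C) (prev s) s
  before-sink-outOnly {s} out-prev out-prev² z = mk⇔ to from ⇔-∘ CArc⇔ C
    where
    to : OArc C (prev s) z → z ≡ s
    to (inj₁ (_ , e))    = trans e (next-prev s)
    to (inj₂ (in-z , e)) = contradiction (trans (sym out-prev²) (trans (orient-prev e) in-z)) λ ()
    from : z ≡ s → OArc C (prev s) z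
    from refl = inj₁ (out-prev , sym (next-prev s))

  forward-off-last : (∀ j → Inward C j → j ≡ L) → o 0F ≡ true → ∀ i → i ≢ L → o i ≡ true
  forward-off-last last-only o₀ = <-weakInduction (λ i → i ≢ L → o i ≡ true) (λ _ → o₀) step
    where
    step : ∀ k → (inject₁ k ≢ L → o (inject₁ k) ≡ true) → sucF k ≢ L → o (sucF k) ≡ true
    step k ih k+1≢L with o (sucF k) in e
    ... | true  = refl
    ... | false = contradiction (last-only (sucF k) (ih (fromℕ≢inject₁ ∘ sym) , e)) k+1≢L

  forward-everywhere : (∀ j → ¬ Inward C j) → o 0F ≡ true → ∀ i → o i ≡ true
  forward-everywhere none o₀ i with i ≟ L
  ... | no i≢L   = forward-off-last (λ j → ⊥-elim ∘ none j) o₀ i i≢L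
  ... | yes refl with o L in e
  ...   | true  = refl
  ...   | false =
    contradiction (forward-off-last (λ j → ⊥-elim ∘ none j) o₀ (prev L) (fromℕ≢inject₁ ∘ sym) , e) (none L)

  forward-≅ : (∀ i → o i ≡ true) → CArc C ≅ CycleArc
  forward-≅ forward = mk≅ (↔-id _) λ i j → mk⇔ to (λ e → inj₁ (forward i , e)) ⇔-∘ CArc⇔ C
    where
    to : ∀ {i j} → OArc C i j → CycleArc i j
    to (inj₁ (_ , e))         = e
    to {j = j} (inj₂ (in-j , _)) = contradiction (trans (sym (forward j)) in-j) λ ()

  forward-but-last-≅ : (∀ i → i ≢ L → o i ≡ true) → o L ≡ false → CArc C ≅ ThetaArc
  forward-but-last-≅ forward in-L = mk≅ (↔-id _) λ i j → mk⇔ to from ⇔-∘ CArc⇔ C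
    where
    to : ∀ {i j} → OArc C i j → ThetaArc i j
    to {i} (inj₁ (out-i , e)) with i ≟ L
    ... | yes refl = contradiction (trans (sym out-i) in-L) λ ()
    ... | no i≢L   = inj₁ (≢fromℕ⇒< i≢L , e)
    to {j = j} (inj₂ (in-j , e)) with j ≟ L
    ... | yes refl = inj₂ (trans e next-fromℕ , refl)
    ... | no j≢L   = contradiction (trans (sym (forward j j≢L)) in-j) λ ()
    from : ∀ {i j} → ThetaArc i j → OArc C i j
    from {i} (inj₁ (p , e))      = inj₁ (forward i (<⇒≢fromℕ p) , e)
    from (inj₂ (refl , refl))    = inj₂ (in-L , sym next-fromℕ)

module _ (C : OCycle) where
  private
    o = OCycle.orient C

  rotated-≅ : ∀ r → CArc C ≅ CArc (rotated r C)
  rotated-≅ r = mk≅ (rotation r) λ i j →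
    ⇔-sym (CArc⇔ (rotated r C)) ⇔-∘ (((⇔-id _ ×-⇔ shift) ⊎-⇔ (⇔-id _ ×-⇔ shift)) ⇔-∘ CArc⇔ C)
    where
    shift : ∀ {i j} → rotate r j ≡ next (rotate r i) ⇔ j ≡ next i
    shift {i} = mk⇔ (λ e → to-injective (rotation r) (trans e (sym (rotate-next r i))))
                    (λ e → trans (cong (rotate r) e) (rotate-next r i))

  rotated-inward : ∀ r {j} → Inward (rotated r C) j → Inward C (rotate r j)
  rotated-inward r {j} (in-prev , in-j) = trans (cong o (sym (rotate-prev r j))) in-prev , in-j

  reflected-≅ : CArc C ≅ CArc (reflected C)
  reflected-≅ = mk≅ Perm.reverse λ i j →
    ⇔-sym (CArc⇔ (reflected C)) ⇔-∘ (mk⇔ Sum.swap Sum.swap ⇔-∘ ((flip i j ⊎-⇔ flip j i) ⇔-∘ CArc⇔ C))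
    where
    o′ = OCycle.orient (reflected C)
    flip : ∀ i j {b} → (o (opposite i) ≡ b × opposite j ≡ next (opposite i)) ⇔ (o′ j ≡ not b × i ≡ next j)
    flip i j = mk⇔ to from
      where
      to : ∀ {b} → o (opposite i) ≡ b × opposite j ≡ next (opposite i) → o′ j ≡ not b × i ≡ next j
      to (refl , e) = cong (not ∘ o) prev-opp-j , sym (to-injective Perm.reverse (trans (opposite-next j) prev-opp-j))
        where
        prev-opp-j : prev (opposite j) ≡ opposite i
        prev-opp-j = trans (cong prev e) (prev-next (opposite i))
      from : ∀ {b} → o′ j ≡ not b × i ≡ next j → o (opposite i) ≡ b × opposite j ≡ next (opposite i)
      from (e , refl) = not-injective (trans (cong (not ∘ o) (opposite-next j)) e) ,
                        trans (sym (next-prev (opposite j))) (cong next (sym (opposite-next j)))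

  reflected-inward : ∀ {j} → Inward (reflected C) j → Inward C (opposite j)
  reflected-inward {j} (in-prev , in-j) =
    not-injective in-j , not-injective (trans (cong (not ∘ o) (sym opp-prev)) in-prev)
    where
    opp-prev : prev (opposite (prev j)) ≡ opposite j
    opp-prev = trans (sym (opposite-next (prev j))) (cong opposite (next-prev j))

module _ (C : OCycle) where
  private
    o = OCycle.orient C

  unidirectional-of-¬inward : (∀ j → ¬ Inward C j) → Unidirectional C
  unidirectional-of-¬inward none with any? (λ i → o i Bool.≟ true)
  ... | yes (r , out-r) = Equivalence.from (unidirectional⇔ C)
          (≅-trans (rotated-≅ C (toℕ r)) (forward-≅ D (forward-everywhere D none-D out-0)))
    where
    D = rotated (toℕ r) C
    none-D : ∀ j → ¬ Inward D j
    none-D j = none _ ∘ rotated-inward C (toℕ r)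
    out-0 : o (rotate (toℕ r) 0F) ≡ true
    out-0 = trans (cong o (rotate-toℕ r)) out-r
  ... | no ¬out = Equivalence.from (unidirectional⇔ C)
          (≅-trans (reflected-≅ C) (forward-≅ (reflected C) λ i → cong not (Bool.¬-not λ e → ¬out (_ , e))))

  thetaOriented-of-sink-then-source : ∀ {s} → (∀ j → Inward C j → j ≡ s) →
    o s ≡ false → o (next s) ≡ true → ThetaOriented C
  thetaOriented-of-sink-then-source {s} sink-only in-s out-next = Equivalence.from (thetaOriented⇔ C)
    (≅-trans (rotated-≅ C r) (forward-but-last-≅ D (forward-off-last D last-only out-0) in-L))
    where
    r = suc (toℕ s)
    D = rotated r C
    L = fromℕ (2 + OCycle.len C)
    in-L : o (rotate r L) ≡ false
    in-L = trans (cong o (rotate-fromℕ s)) in-s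
    out-0 : o (rotate r 0F) ≡ true
    out-0 = trans (cong (o ∘ next) (rotate-toℕ s)) out-next
    last-only : ∀ j → Inward D j → j ≡ L
    last-only j in-j = to-injective (rotation r) (trans (sink-only _ (rotated-inward C r in-j)) (sym (rotate-fromℕ s)))

module _ (C : OCycle) where
  private
    o = OCycle.orient C

  thetaOriented-of-source-then-sink : ∀ {s} → (∀ j → Inward C j → j ≡ s) →
    Inward C s → o (prev (prev s)) ≡ false → ThetaOriented C
  thetaOriented-of-source-then-sink {s} sink-only (in-prev , _) in-prev² = Equivalence.from (thetaOriented⇔ C)
    (≅-trans (reflected-≅ C) (Equivalence.to (thetaOriented⇔ D)
      (thetaOriented-of-sink-then-source D {opposite s} sink-only-D in-s-D out-next-D)))
    where
    D = reflected C
    sink-only-D : ∀ j → Inward D j → j ≡ opposite s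
    sink-only-D j in-j = trans (sym (opposite-involutive j)) (cong opposite (sink-only _ (reflected-inward C {j} in-j)))
    in-s-D : OCycle.orient D (opposite s) ≡ false
    in-s-D = trans (cong (not ∘ o ∘ prev) (opposite-involutive s)) (cong not in-prev)
    out-next-D : OCycle.orient D (next (opposite s)) ≡ true
    out-next-D = trans (cong (not ∘ o ∘ prev) (trans (opposite-next (opposite s)) (cong prev (opposite-involutive s))))
                       (cong not in-prev²)

  inward-unique : DistinctRows (CArc C) → ∀ {s} → Inward C s → ∀ j → Inward C j → j ≡ s
  inward-unique distinct in-s j in-j = sinks-equal (CArc C) distinct (inward⇒sink C in-j) (inward⇒sink C in-s)

  thetaOriented-of-inward : DistinctRows (CArc C) → ∀ {s} → Inward C s → ThetaOriented C
  thetaOriented-of-inward distinct {s} in-s with o (next s) in out-next | o (prev (prev s)) in out-prev²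
  ... | true  | _     = thetaOriented-of-sink-then-source C (inward-unique distinct in-s) (proj₂ in-s) out-next
  ... | false | false = thetaOriented-of-source-then-sink (inward-unique distinct in-s) in-s out-prev²
  ... | false | true  = contradiction -- neither neighbour of s is a source
    (outOnly-equal (CArc C) distinct (after-sink-outOnly C (proj₂ in-s) out-next)
                                     (before-sink-outOnly C (proj₁ in-s) out-prev²))
    λ e → next²≢id s (trans (cong next e) (next-prev s))

  distinctRows⇒unidirectional⊎thetaOriented : DistinctRows (CArc C) → Unidirectional C ⊎ ThetaOriented C
  distinctRows⇒unidirectional⊎thetaOriented distinct with any? (inward? C)
  ... | yes (s , in-s) = inj₂ (thetaOriented-of-inward distinct in-s)
  ... | no ¬inward     = inj₁ (unidirectional-of-¬inward C λ j in-j → ¬inward (j , in-j))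

-- Weights

sumFin : (n : ℕ) → (Fin n → ℕ) → ℕ
sumFin n g = sum (map g (allFin n))

sumFin-suc : ∀ n (g : Fin (suc n) → ℕ) → sumFin (suc n) g ≡ g 0F + sumFin n (g ∘ sucF)
sumFin-suc n g = cong (λ l → g 0F + sum l) (trans (map-tabulate sucF g) (sym (map-tabulate (λ i → i) (g ∘ sucF))))

sumFin-cong : ∀ n {g h : Fin n → ℕ} → (∀ i → g i ≡ h i) → sumFin n g ≡ sumFin n h
sumFin-cong n g≗h = cong sum (map-cong g≗h (allFin n))

sumFin-zero : ∀ n {g : Fin n → ℕ} → (∀ i → g i ≡ 0) → sumFin n g ≡ 0
sumFin-zero zero    g≡0 = refl
sumFin-zero (suc n) {g} g≡0 = trans (sumFin-suc n g) (cong₂ _+_ (g≡0 0F) (sumFin-zero n (g≡0 ∘ sucF)))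

sumFin-point : ∀ n {g : Fin n → ℕ} a → (∀ i → i ≢ a → g i ≡ 0) → sumFin n g ≡ g a
sumFin-point (suc n) {g} 0F g≡0 = begin
  sumFin (suc n) g           ≡⟨ sumFin-suc n g ⟩
  g 0F + sumFin n (g ∘ sucF) ≡⟨ cong (g 0F +_) (sumFin-zero n λ i → g≡0 (sucF i) λ ()) ⟩
  g 0F + 0                   ≡⟨ +-identityʳ (g 0F) ⟩
  g 0F                       ∎
  where open ≡-Reasoning
sumFin-point (suc n) {g} (sucF a) g≡0 = begin
  sumFin (suc n) g           ≡⟨ sumFin-suc n g ⟩
  g 0F + sumFin n (g ∘ sucF)
    ≡⟨ cong₂ _+_ (g≡0 0F λ ()) (sumFin-point n a λ i i≢a → g≡0 (sucF i) (i≢a ∘ sucF-injective)) ⟩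
  g (sucF a)                 ∎
  where open ≡-Reasoning

sumFin-pair : ∀ n {g : Fin n → ℕ} {a b} → a ≢ b →
  (∀ i → i ≢ a → i ≢ b → g i ≡ 0) → sumFin n g ≡ g a + g b
sumFin-pair (suc n) {g} {0F} {0F} a≢b g≡0 = contradiction refl a≢b
sumFin-pair (suc n) {g} {0F} {sucF b} a≢b g≡0 = trans (sumFin-suc n g)
  (cong (g 0F +_) (sumFin-point n b λ i i≢b → g≡0 (sucF i) (λ ()) (i≢b ∘ sucF-injective)))
sumFin-pair (suc n) {g} {sucF a} {0F} a≢b g≡0 = trans (sumFin-suc n g) (trans (+-comm (g 0F) _)
  (cong (_+ g 0F) (sumFin-point n a λ i i≢a → g≡0 (sucF i) (i≢a ∘ sucF-injective) (λ ()))))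
sumFin-pair (suc n) {g} {sucF a} {sucF b} a≢b g≡0 = trans (sumFin-suc n g) (cong₂ _+_ (g≡0 0F (λ ()) (λ ()))
  (sumFin-pair n (a≢b ∘ cong sucF) λ i i≢a i≢b → g≡0 (sucF i) (i≢a ∘ sucF-injective) (i≢b ∘ sucF-injective)))

module _ {n : ℕ} (r : Fin n → Bool) (ℓ : Fin n → ℕ) where

  selectSum : ℕ
  selectSum = sumFin n λ z → if r z then ℓ z else 0

  private
    unselected : ∀ {z} → ¬ T (r z) → (if r z then ℓ z else 0) ≡ 0
    unselected {z} ¬r with r z
    ... | true  = contradiction _ ¬r
    ... | false = refl

    selected : ∀ {z} → T (r z) → (if r z then ℓ z else 0) ≡ ℓ z
    selected {z} rz with r z
    ... | true = refl

  selectSum-none : (∀ z → ¬ T (r z)) → selectSum ≡ 0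
  selectSum-none none = sumFin-zero n λ z → unselected (none z)

  selectSum-one : ∀ {y} → (∀ z → T (r z) ⇔ z ≡ y) → selectSum ≡ ℓ y
  selectSum-one {y} only = trans (sumFin-point n y λ z z≢y → unselected (z≢y ∘ Equivalence.to (only z)))
    (selected (Equivalence.from (only y) refl))

  selectSum-two : ∀ {a b} → a ≢ b → (∀ z → T (r z) ⇔ (z ≡ a ⊎ z ≡ b)) → selectSum ≡ ℓ a + ℓ b
  selectSum-two {a} {b} a≢b pair = trans
    (sumFin-pair n a≢b λ z z≢a z≢b → unselected (Sum.[ z≢a , z≢b ] ∘ Equivalence.to (pair z)))
    (cong₂ _+_ (selected (Equivalence.from (pair a) (inj₁ refl))) (selected (Equivalence.from (pair b) (inj₂ refl))))

selectSum-cong : ∀ {n} {r r′ : Fin n → Bool} (ℓ : Fin n → ℕ) →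
  (∀ z → r z ≡ r′ z) → selectSum r ℓ ≡ selectSum r′ ℓ
selectSum-cong {n} ℓ r≗r′ = sumFin-cong n λ z → cong (λ b → if b then ℓ z else 0) (r≗r′ z)

sum-map-concatMap : {A B : Set} (h : B → ℕ) (f : A → List B) (xs : List A) →
  sum (map h (concatMap f xs)) ≡ sum (map (sum ∘ map h ∘ f) xs)
sum-map-concatMap h f []       = refl
sum-map-concatMap h f (x ∷ xs) = begin
  sum (map h (f x ++ concatMap f xs))              ≡⟨ cong sum (map-++ h (f x) (concatMap f xs)) ⟩
  sum (map h (f x) ++ map h (concatMap f xs))      ≡⟨ sum-++ (map h (f x)) (map h (concatMap f xs)) ⟩
  sum (map h (f x)) + sum (map h (concatMap f xs)) ≡⟨ cong (sum (map h (f x)) +_) (sum-map-concatMap h f xs) ⟩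
  sum (map h (f x)) + sum (map (sum ∘ map h ∘ f) xs) ∎
  where open ≡-Reasoning

Σ-split : ∀ {m} (P : Fin (suc m) → Set) → Σ (Fin (suc m)) P ↔ (P 0F ⊎ Σ (Fin m) (P ∘ sucF))
Σ-split P = mk↔ₛ′ to from to-from from-to
  where
  to : Σ _ P → P 0F ⊎ Σ _ (P ∘ sucF)
  to (0F , p)     = inj₁ p
  to (sucF i , p) = inj₂ (i , p)
  from : P 0F ⊎ Σ _ (P ∘ sucF) → Σ _ P
  from (inj₁ p)       = 0F , p
  from (inj₂ (i , p)) = sucF i , p
  to-from : ∀ y → to (from y) ≡ y
  to-from (inj₁ _) = refl
  to-from (inj₂ _) = refl
  from-to : ∀ x → from (to x) ≡ x
  from-to (0F , _)     = refl
  from-to (sucF _ , _) = refl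

Σ-Fin↔ : ∀ m (s : Fin m → ℕ) → Σ (Fin m) (Fin ∘ s) ↔ Fin (sumFin m s)
Σ-Fin↔ zero    s = mk↔ₛ′ (λ ()) (λ ()) (λ ()) (λ ())
Σ-Fin↔ (suc m) s = subst (λ k → Σ (Fin (suc m)) (Fin ∘ s) ↔ Fin k) (sym (sumFin-suc m s))
  (↔-sym +↔⊎ ↔-∘ ((↔-id _ ⊎-↔ Σ-Fin↔ m (s ∘ sucF)) ↔-∘ Σ-split (Fin ∘ s)))

top-labelling : {A : Set} {n : ℕ} → A ↔ Fin n → (a : A) →
  Σ (A ↔ Fin n) λ F → ∀ y → toℕ (Inverse.to F y) ≤ toℕ (Inverse.to F a)
top-labelling {n = zero}  F₀ a with () ← Inverse.to F₀ a
top-labelling {n = suc k} F₀ a = F , bound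
  where
  F = Perm.transpose (Inverse.to F₀ a) (fromℕ k) ↔-∘ F₀
  a-on-top : ∀ {i j : Fin (suc k)} → PC.transpose i j i ≡ j
  a-on-top {i} with i ≟ i
  ... | yes _   = refl
  ... | no i≢i = contradiction refl i≢i
  bound : ∀ y → toℕ (Inverse.to F y) ≤ toℕ (Inverse.to F a)
  bound y rewrite a-on-top {Inverse.to F₀ a} {fromℕ k} = ≤fromℕ (Inverse.to F y)

module _ (G : O2RGraph) where
  open O2RGraph G

  label : (Vertex G ⤖ Fin (order G)) → Vertex G → ℕ
  label F y = suc (toℕ (Bijection.to F y))

  arc-within : ∀ c x y → arc G (c , x) (c , y) ≡ carc (comp c) x y
  arc-within c x y with c ≟ c
  ... | yes refl = refl
  ... | no c≢c   = contradiction refl c≢c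

  arc-between : ∀ {c c′} x y → c′ ≢ c → arc G (c , x) (c′ , y) ≡ false
  arc-between {c} {c′} x y c′≢c with c ≟ c′
  ... | yes c≡c′ = contradiction (sym c≡c′) c′≢c
  ... | no _     = refl

  weight1-component : ∀ F c x → weight1 G F (c , x) ≡ selectSum (carc (comp c) x) (λ j → label F (c , j))
  weight1-component F c x = begin
    weight1 G F (c , x)
      ≡⟨ sum-map-concatMap h (λ c′ → map (c′ ,_) (allFin _)) (allFin m) ⟩
    sumFin m (λ c′ → sum (map h (map (c′ ,_) (allFin _))))
      ≡⟨ sumFin-point m c only-c ⟩
    sum (map h (map (c ,_) (allFin _)))
      ≡⟨ cong sum (map-∘ {g = h} {f = c ,_} (allFin _)) ⟨
    sumFin (size (comp c)) (λ j → h (c , j))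
      ≡⟨ sumFin-cong _ (λ j → cong (λ b → if b then label F (c , j) else 0) (arc-within c x j)) ⟩
    selectSum (carc (comp c) x) (λ j → label F (c , j))
      ∎
    where
    open ≡-Reasoning
    h : Vertex G → ℕ
    h y = if arc G (c , x) y then label F y else 0
    only-c : ∀ c′ → c′ ≢ c → sum (map h (map (c′ ,_) (allFin _))) ≡ 0
    only-c c′ c′≢c = trans (cong sum (sym (map-∘ {g = h} {f = c′ ,_} (allFin _))))
      (sumFin-zero _ λ j → cong (λ b → if b then label F (c′ , j) else 0) (arc-between x j c′≢c))

  module _ (F : Vertex G ⤖ Fin (order G)) (c : Fin m) (x : Fin (size (comp c))) where

    weight1-sink : Sink (CArc (comp c)) x → weight1 G F (c , x) ≡ 0
    weight1-sink s = trans (weight1-component F c x) (selectSum-none _ _ s)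

    weight1-outOnly : ∀ {y} → OutOnly (CArc (comp c)) x y → weight1 G F (c , x) ≡ label F (c , y)
    weight1-outOnly o = trans (weight1-component F c x) (selectSum-one _ _ o)

    weight1-outPair : ∀ {a b} → OutPair (CArc (comp c)) x a b →
      weight1 G F (c , x) ≡ label F (c , a) + label F (c , b)
    weight1-outPair (a≢b , p) = trans (weight1-component F c x) (selectSum-two _ _ a≢b p)

  ,-injectiveʳ-Vertex : ∀ {c} {x x′ : Fin (size (comp c))} → _≡_ {A = Vertex G} (c , x) (c , x′) → x ≡ x′
  ,-injectiveʳ-Vertex refl = refl

  antimagic⇒distinctRows : Antimagic1 G → ∀ c → DistinctRows (CArc (comp c))
  antimagic⇒distinctRows (F , distinct) c x x′ same-row = ,-injectiveʳ-Vertex (distinct _ _ (begin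
    weight1 G F (c , x)                                  ≡⟨ weight1-component F c x ⟩
    selectSum (carc (comp c) x) (λ j → label F (c , j))  ≡⟨ selectSum-cong _ (λ z → T-injective (same-row z)) ⟩
    selectSum (carc (comp c) x′) (λ j → label F (c , j)) ≡⟨ weight1-component F c x′ ⟨
    weight1 G F (c , x′)                                 ∎))
    where
    open ≡-Reasoning
    T-injective : ∀ {a b} → T a ⇔ T b → a ≡ b
    T-injective a⇔b = Bool.⇔→≡ {z = true} (T-≡ ⇔-∘ (a⇔b ⇔-∘ ⇔-sym T-≡))

  antimagic⇒theta-unique : Antimagic1 G →
    ∀ c c′ → ThetaOriented (comp c) → ThetaOriented (comp c′) → c ≡ c′
  antimagic⇒theta-unique (F , distinct) c c′ θ θ′ =
    cong proj₁ (distinct _ _ (trans (sink-weight c θ) (sym (sink-weight c′ θ′))))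
    where
    sink-weight : ∀ c (θ : ThetaOriented (comp c)) → weight1 G F (c , proj₁ (thetaOriented-sink (comp c) θ)) ≡ 0
    sink-weight c θ = weight1-sink F c _ (proj₂ (thetaOriented-sink (comp c) θ))

  module _ (hyp : ∀ c → Unidirectional (comp c) ⊎ ThetaOriented (comp c))
           (theta-unique : ∀ c c′ → ThetaOriented (comp c) → ThetaOriented (comp c′) → c ≡ c′) where

    private
      theta-of : ∀ c {x} → Sink (CArc (comp c)) x → ThetaOriented (comp c)
      theta-of c {x} = thetaOriented-of-sink (comp c) (hyp c) {x}

    SinkVertex : Vertex G → Set
    SinkVertex (c , x) = Sink (CArc (comp c)) x

    sinkVertex-unique : ∀ u v → SinkVertex u → SinkVertex v → u ≡ v
    sinkVertex-unique (c , x) (c′ , x′) s s′ with theta-unique c c′ (theta-of c s) (theta-of c′ s′)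
    ... | refl = cong (c ,_) (sink-unique (comp c) (theta-of c s) {x} {x′} s s′)

    sink-on-top : Σ (Vertex G ⤖ Fin (order G)) λ F → ∀ v → SinkVertex v → ∀ y → label F y ≤ label F v
    sink-on-top with any? (λ c → any? (sink? (comp c)))
    ... | yes (c , x , s) = ↔⇒⤖ F , λ v s′ y →
            subst (λ u → label (↔⇒⤖ F) y ≤ label (↔⇒⤖ F) u) (sinkVertex-unique _ _ s s′) (s≤s (top y))
      where
      F   = proj₁ (top-labelling (Σ-Fin↔ m (size ∘ comp)) (c , x))
      top = proj₂ (top-labelling (Σ-Fin↔ m (size ∘ comp)) (c , x))
    ... | no ¬sink = ↔⇒⤖ (Σ-Fin↔ m (size ∘ comp)) , λ (c , x) s → ⊥-elim (¬sink (c , x , s))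

    module _ (F : Vertex G ⤖ Fin (order G)) (sink-top : ∀ v → SinkVertex v → ∀ y → label F y ≤ label F v) where

      private
        NonSink : ∀ c → Fin (size (comp c)) → Set
        NonSink c x = (∃ λ y → OutOnly (CArc (comp c)) x y)
                    ⊎ (∃₂ λ a b → OutPair (CArc (comp c)) x a b × Sink (CArc (comp c)) b)

        positive-weight : ∀ c x → NonSink c x → 0 < weight1 G F (c , x)
        positive-weight c x (inj₁ (_ , o))         = subst (0 <_) (sym (weight1-outOnly F c x o)) (s≤s z≤n)
        positive-weight c x (inj₂ (_ , _ , p , _)) = subst (0 <_) (sym (weight1-outPair F c x p)) (s≤s z≤n)

        pair-heavier : ∀ c x {y} c′ x′ {a b} → OutOnly (CArc (comp c)) x y → OutPair (CArc (comp c′)) x′ a b →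
          Sink (CArc (comp c′)) b → weight1 G F (c , x) < weight1 G F (c′ , x′)
        pair-heavier c x {y} c′ x′ {a} {b} o p s = begin-strict
          weight1 G F (c , x)               ≡⟨ weight1-outOnly F c x o ⟩
          label F (c , y)                   ≤⟨ sink-top (c′ , b) s (c , y) ⟩
          label F (c′ , b)                  <⟨ m<n+m _ (s≤s z≤n) ⟩
          label F (c′ , a) + label F (c′ , b) ≡⟨ weight1-outPair F c′ x′ p ⟨
          weight1 G F (c′ , x′)             ∎
          where open ≤-Reasoning

        label-injective : ∀ {u v} → label F u ≡ label F v → u ≡ v
        label-injective e = Bijection.injective F (toℕ-injective (suc-injective e))

        same-outOnly : ∀ c x c′ x′ {y y′} → OutOnly (CArc (comp c)) x y → OutOnly (CArc (comp c′)) x′ y′ →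
          weight1 G F (c , x) ≡ weight1 G F (c′ , x′) → (c , x) ≡ (c′ , x′)
        same-outOnly c x c′ x′ o o′ w≡
          with label-injective (trans (sym (weight1-outOnly F c x o)) (trans w≡ (weight1-outOnly F c′ x′ o′)))
        ... | refl = cong (c ,_) (outOnly-injective (comp c) (hyp c) o o′)

        same-outPair : ∀ c x c′ x′ {a b a′ b′} →
          OutPair (CArc (comp c)) x a b → OutPair (CArc (comp c′)) x′ a′ b′ →
          Sink (CArc (comp c)) b → Sink (CArc (comp c′)) b′ → (c , x) ≡ (c′ , x′)
        same-outPair c x c′ x′ {b = b} {b′ = b′} p p′ s s′
          with theta-unique c c′ (theta-of c {b} s) (theta-of c′ {b′} s′)
        ... | refl = cong (c ,_) (outPair-unique (comp c) (theta-of c {b} s) p p′)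

      distinct-weights : ∀ u v → weight1 G F u ≡ weight1 G F v → u ≡ v
      distinct-weights (c , x) (c′ , x′) w≡ with kind (comp c) (hyp c) x | kind (comp c′) (hyp c′) x′
      ... | inj₁ s | inj₁ s′ = sinkVertex-unique _ _ s s′
      ... | inj₁ s | inj₂ k′ =
        contradiction (trans (sym (weight1-sink F c x s)) w≡) (<⇒≢ (positive-weight c′ x′ k′))
      ... | inj₂ k | inj₁ s′ =
        contradiction (trans (sym (weight1-sink F c′ x′ s′)) (sym w≡)) (<⇒≢ (positive-weight c x k))
      ... | inj₂ (inj₁ (_ , o)) | inj₂ (inj₁ (_ , o′)) = same-outOnly c x c′ x′ o o′ w≡
      ... | inj₂ (inj₁ (_ , o)) | inj₂ (inj₂ (_ , _ , p′ , s′)) =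
        contradiction w≡ (<⇒≢ (pair-heavier c x c′ x′ o p′ s′))
      ... | inj₂ (inj₂ (_ , _ , p , s)) | inj₂ (inj₁ (_ , o′)) =
        contradiction (sym w≡) (<⇒≢ (pair-heavier c′ x′ c x o′ p s))
      ... | inj₂ (inj₂ (_ , _ , p , s)) | inj₂ (inj₂ (_ , _ , p′ , s′)) = same-outPair c x c′ x′ p p′ s s′

mainTheorem5 : (G : O2RGraph) → 2 ≤ O2RGraph.m G →
    Antimagic1 G ⇔
      (((c : Fin (O2RGraph.m G)) →
          Unidirectional (O2RGraph.comp G c) ⊎ ThetaOriented (O2RGraph.comp G c))
       × ((c c' : Fin (O2RGraph.m G)) →
          ThetaOriented (O2RGraph.comp G c) → ThetaOriented (O2RGraph.comp G c') → c ≡ c'))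
mainTheorem5 G _ = mk⇔
  (λ antimagic → (λ c → distinctRows⇒unidirectional⊎thetaOriented (comp c) (antimagic⇒distinctRows G antimagic c))
               , antimagic⇒theta-unique G antimagic)
  (λ (hyp , theta-unique) → let (F , sink-top) = sink-on-top G hyp theta-unique in
                            F , distinct-weights G hyp theta-unique F sink-top)
  where open O2RGraph G
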